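{- There exist a (non-bipartite) graph $G$ and preference orders such that the RDO algorithm satisfies $\mathbb{E}[|M|]\le 0.625\cdot|M^*|$, where $M$ is its output and $M^*$ a maximum matching of $G$. In particular, RDO is at most $0.625$-approximate on general graphs.
   Context: RDO: every vertex $u$ independently draws a rank $y_u$ uniformly from $[0,1]$; vertices are processed in ascending order of ranks; when $u$ is processed, if $u$ is unmatched and has an unmatched neighbor, it is matched to the unmatched neighbor first in its fixed preference order (an arbitrary strict total order over the other vertices, independent of the ranks). -}

module Defs where

open import Data.Nat using (ℕ; zero; suc; _+_; _*_; _≤_; _<ᵇ_)
open import Data.Nat.ListAction using (sum)

open import Data.Bool using (Bool; true; false; not; _∧_; if_then_else_)
open import Data.Fin using (Fin; toℕ)
open import Data.Fin.Permutation using (Permutation′; _⟨$⟩ʳ_)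
open import Data.List using (List; []; _∷_; map; concatMap; foldl; foldr; length; allFin)
open import Data.List.Relation.Unary.All using (All)
open import Data.List.Relation.Unary.Unique.Propositional using (Unique)
open import Data.Maybe using (Maybe; just; nothing)
open import Data.Product using (_×_; _,_; proj₁; proj₂; Σ; ∃)
open import Relation.Binary.PropositionalEquality using (_≡_; _≢_)
open import Relation.Nullary using (¬_)

record Graph (n : ℕ) : Set where
  field
    adj     : Fin n → Fin n → Bool
    symm    : ∀ u v → adj u v ≡ adj v u
    loopless : ∀ u → adj u u ≡ false
open Graph public

Bipartite : ∀ {n} → Graph n → Set
Bipartite {n} G = Σ (Fin n → Bool) λ c → ∀ u v → adj G u v ≡ true → c u ≢ c v

endpoints : ∀ {n} → List (Fin n × Fin n) → List (Fin n)
endpoints = concatMap (λ e → proj₁ e ∷ proj₂ e ∷ [])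

IsMatching : ∀ {n} → Graph n → List (Fin n × Fin n) → Set
IsMatching G M = All (λ e → adj G (proj₁ e) (proj₂ e) ≡ true) M × Unique (endpoints M)

IsMaximumMatching : ∀ {n} → Graph n → List (Fin n × Fin n) → Set
IsMaximumMatching G M = IsMatching G M × (∀ M′ → IsMatching G M′ → length M′ ≤ length M)

-- Preference orders: for each vertex u, a strict total order on vertices given by
-- a ranking permutation (v is preferred over w by u iff rank_u v < rank_u w).
-- Only its restriction to the other vertices is ever used.
Preferences : ℕ → Set
Preferences n = Fin n → Permutation′ n

-- RDO state: which vertices are matched, and the number of edges matched so far.
State : ℕ → Set
State n = (Fin n → Bool) × ℕ

bestNeighbour : ∀ {n} → Graph n → Preferences n → (Fin n → Bool) → Fin n → Maybe (Fin n)
bestNeighbour {n} G π matched u = foldr step nothing (allFin n)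
  where
  rk : Fin n → ℕ
  rk v = toℕ (π u ⟨$⟩ʳ v)
  step : Fin n → Maybe (Fin n) → Maybe (Fin n)
  step v best with adj G u v ∧ not (matched v)
  ... | false = best
  ... | true with best
  ...   | nothing = just v
  ...   | just w = if rk v <ᵇ rk w then just v else just w

mark : ∀ {n} → Fin n → (Fin n → Bool) → (Fin n → Bool)
mark {n} u m v with Data.Fin._≟_ u v
... | Relation.Nullary.yes _ = true
... | Relation.Nullary.no _ = m v

process : ∀ {n} → Graph n → Preferences n → State n → Fin n → State n
process G π (m , k) u with m u
... | true = (m , k)
... | false with bestNeighbour G π m u
...   | nothing = (m , k)
...   | just v = (mark v (mark u m) , suc k)

rdoSize : ∀ {n} → Graph n → Preferences n → List (Fin n) → ℕ
rdoSize G π order = proj₂ (foldl (process G π) ((λ _ → false) , 0) order)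

insertAll : {A : Set} → A → List A → List (List A)
insertAll x [] = (x ∷ []) ∷ []
insertAll x (y ∷ ys) = (x ∷ y ∷ ys) ∷ map (y ∷_) (insertAll x ys)

perms : {A : Set} → List A → List (List A)
perms [] = [] ∷ []
perms (x ∷ xs) = concatMap (insertAll x) (perms xs)

-- Ranks i.i.d. uniform on [0,1] are a.s. distinct and induce a uniformly random
-- processing order; hence E[|M|] = (1/n!) * totalRDO.
totalRDO : ∀ {n} → Graph n → Preferences n → ℕ
totalRDO {n} G π = sum (map (rdoSize G π) (perms (allFin n)))

{-# OPTIONS --safe #-}
-- The witness is the paw: a triangle a b c with a pendant vertex d attached to a, every
-- vertex preferring neighbours of smaller index. Its maximum matching {ad, bc} is perfect.
-- RDO finds it only when d is processed first: otherwise the first processed triangle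
-- vertex is matched inside the triangle, isolating d and the remaining triangle vertex.
-- So E[|M|] = 1 + 1/4 = 5/4 = 0.625 · 2, i.e. the 24 orders yield 24 + 6 = 30 matched edges.
module Submission where

open import Defs
open import Data.Nat using (ℕ; _+_; _*_; _≤_; _!)
open import Data.Nat.Properties using (≤-trans; ≤-reflexive; *-suc; *-cancelˡ-≤)
open import Data.Bool using (Bool; true; false; _∨_)
open import Data.Bool.Properties using (∨-comm)
open import Data.Empty using (⊥; ⊥-elim)
open import Data.Fin using (Fin; zero; suc)
open import Data.Fin.Properties using (injective⇒≤)
open import Data.Fin.Permutation using (id)
open import Data.List using (List; []; _∷_; length; lookup)
open import Data.List.Membership.Propositional.Properties using (∈-lookup)
open import Data.List.Relation.Unary.All as All using ([]; _∷_)
open import Data.List.Relation.Unary.AllPairs using (AllPairs; []; _∷_)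
open import Data.List.Relation.Unary.Unique.Propositional using (Unique)
open import Data.Product using (Σ; _×_; _,_)
open import Function.Definitions using (Injective)
open import Relation.Nullary using (¬_)
open import Relation.Binary.PropositionalEquality using (_≡_; _≢_; refl; sym; trans; cong; cong₂)

lookup-injective : ∀ {A : Set} {xs : List A} → AllPairs _≢_ xs → Injective _≡_ _≡_ (lookup xs)
lookup-injective (_ ∷ _)   {zero}  {zero}  _  = refl
lookup-injective (x≢ ∷ _)  {zero}  {suc j} eq = ⊥-elim (All.lookup x≢ (∈-lookup j) eq)
lookup-injective (x≢ ∷ _)  {suc i} {zero}  eq = ⊥-elim (All.lookup x≢ (∈-lookup i) (sym eq))
lookup-injective (_ ∷ xs≢) {suc i} {suc j} eq = cong suc (lookup-injective xs≢ eq)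

Unique⇒length≤ : ∀ {n} {xs : List (Fin n)} → Unique xs → length xs ≤ n
Unique⇒length≤ xs≢ = injective⇒≤ (lookup-injective xs≢)

length-endpoints : ∀ {n} (M : List (Fin n × Fin n)) → length (endpoints M) ≡ 2 * length M
length-endpoints []      = refl
length-endpoints (_ ∷ M) = trans (cong (2 +_) (length-endpoints M)) (sym (*-suc 2 (length M)))

matching⇒2*length≤ : ∀ {n} {G : Graph n} {M} → IsMatching G M → 2 * length M ≤ n
matching⇒2*length≤ {M = M} (_ , unique) =
  ≤-trans (≤-reflexive (sym (length-endpoints M))) (Unique⇒length≤ unique)

perfect⇒maximum : ∀ {n} {G : Graph n} {M} → IsMatching G M → 2 * length M ≡ n →
                  IsMaximumMatching G M
perfect⇒maximum {G = G} {M} isMatching perfect =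
  isMatching , λ M′ isMatching′ →
    *-cancelˡ-≤ {length M′} {length M} 2
      (≤-trans (matching⇒2*length≤ {G = G} isMatching′) (≤-reflexive (sym perfect)))

Bool-no-proper-3-colouring : ∀ (x y z : Bool) → x ≢ y → y ≢ z → x ≢ z → ⊥
Bool-no-proper-3-colouring true  true  _     x≢y _   _   = x≢y refl
Bool-no-proper-3-colouring false false _     x≢y _   _   = x≢y refl
Bool-no-proper-3-colouring true  false true  _   _   x≢z = x≢z refl
Bool-no-proper-3-colouring true  false false _   y≢z _   = y≢z refl
Bool-no-proper-3-colouring false true  true  _   y≢z _   = y≢z refl
Bool-no-proper-3-colouring false true  false _   _   x≢z = x≢z refl

triangle⇒¬Bipartite : ∀ {n} (G : Graph n) {u v w} →
                      adj G u v ≡ true → adj G v w ≡ true → adj G u w ≡ true → ¬ Bipartite G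
triangle⇒¬Bipartite G {u} {v} {w} uv vw uw (colour , proper) =
  Bool-no-proper-3-colouring (colour u) (colour v) (colour w)
    (proper u v uv) (proper v w vw) (proper u w uw)

pattern a = zero
pattern b = suc zero
pattern c = suc (suc zero)
pattern d = suc (suc (suc zero))

pawEdge : Fin 4 → Fin 4 → Bool
pawEdge a b = true
pawEdge a c = true
pawEdge a d = true
pawEdge b c = true
pawEdge _ _ = false

pawEdge-irreflexive : ∀ u → pawEdge u u ≡ false
pawEdge-irreflexive a = refl
pawEdge-irreflexive b = refl
pawEdge-irreflexive c = refl
pawEdge-irreflexive d = refl

paw : Graph 4
paw = record
  { adj      = λ u v → pawEdge u v ∨ pawEdge v u
  ; symm     = λ u v → ∨-comm (pawEdge u v) (pawEdge v u)
  ; loopless = λ u → cong₂ _∨_ (pawEdge-irreflexive u) (pawEdge-irreflexive u)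
  }

byIndex : Preferences 4
byIndex _ = id

pawPerfectMatching : List (Fin 4 × Fin 4)
pawPerfectMatching = (a , d) ∷ (b , c) ∷ []

pawPerfectMatching-isMatching : IsMatching paw pawPerfectMatching
pawPerfectMatching-isMatching =
  refl ∷ refl ∷ [] ,
  ((λ ()) ∷ (λ ()) ∷ (λ ()) ∷ []) ∷ ((λ ()) ∷ (λ ()) ∷ []) ∷
  ((λ ()) ∷ []) ∷ [] ∷ []

paw-totalRDO : totalRDO paw byIndex ≡ 30
paw-totalRDO = refl

theorem4 : Σ ℕ λ n → Σ (Graph n) λ G → Σ (Preferences n) λ π →
    Σ (List (Fin n × Fin n)) λ Mstar →
      ¬ Bipartite G × IsMaximumMatching G Mstar ×
      8 * totalRDO G π ≤ 5 * ((n !) * length Mstar)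
theorem4 =
  4 , paw , byIndex , pawPerfectMatching ,
  triangle⇒¬Bipartite paw {a} {b} {c} refl refl refl ,
  perfect⇒maximum {G = paw} pawPerfectMatching-isMatching refl ,
  ≤-reflexive (cong (8 *_) paw-totalRDO)
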